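{- Let $k \ge 2$ and $t\ge 1$ be integers. Suppose that $G$ is an $(n-1)$-closed graph of order $n$ with $n\ge 6k+6t-1$. If $$e(G) \ge {n-k-t \choose 2}+(k+t-1)^2+k+t,$$ then $\omega (G) \ge n-k-t+1$.
   Context: All graphs are finite, simple and undirected; $e(G)$ is the number of edges and $\omega(G)$ is the clique number (maximum number of vertices of a complete subgraph) of $G$. For an integer $l\ge 0$, the $l$-closure $C_l(G)$ of $G$ is the graph obtained from $G$ by recursively joining pairs of non-adjacent vertices whose degree sum (in the current graph) is at least $l$ until no such pair remains; $G$ is $l$-closed if $C_l(G)=G$, i.e., every two non-adjacent vertices of $G$ have degree sum less than $l$. -}

module Defs where

open import Data.Nat using (ℕ; _+_; _<_; _≤_; _≥_)
open import Data.Nat.Combinatorics using (_C_)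
open import Data.Bool using (Bool; true; false; if_then_else_)
open import Data.Fin using (Fin; toℕ)
open import Data.Fin.Subset using (Subset; _∈_; ∣_∣)
open import Data.List using (List; map; allFin)
open import Data.Nat.ListAction using (sum)
open import Data.Product using (Σ; _×_)
open import Relation.Binary.PropositionalEquality using (_≡_)
open import Relation.Nullary using (¬_)
open import Relation.Nullary.Decidable using (⌊_⌋)
open import Data.Nat.Properties using (_<?_)
open import Data.Bool using (_∧_)

record Graph (n : ℕ) : Set where
  field
    adj     : Fin n → Fin n → Bool
    sym     : ∀ u v → adj u v ≡ adj v u
    irrefl  : ∀ v → adj v v ≡ false
open Graph public

Adj : ∀ {n} → Graph n → Fin n → Fin n → Set
Adj G u v = adj G u v ≡ true

count : ∀ {n} → (Fin n → Bool) → ℕ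
count {n} p = sum (map (λ i → if p i then 1 else 0) (allFin n))

deg : ∀ {n} → Graph n → Fin n → ℕ
deg G v = count (λ u → adj G v u)

edges : ∀ {n} → Graph n → ℕ
edges {n} G = sum (map (λ u → count (λ v → ⌊ toℕ u <? toℕ v ⌋ ∧ adj G u v)) (allFin n))

IsClosed : ∀ {n} → ℕ → Graph n → Set
IsClosed l G = ∀ u v → ¬ (u ≡ v) → ¬ Adj G u v → deg G u + deg G v < l

IsClique : ∀ {n} → Graph n → Subset n → Set
IsClique G S = ∀ u v → u ∈ S → v ∈ S → ¬ (u ≡ v) → Adj G u v

CliqueNumberAtLeast : ∀ {n} → Graph n → ℕ → Set
CliqueNumberAtLeast G m = Σ (Subset _) λ S → IsClique G S × m ≤ ∣ S ∣

-- Pass to the complement K of G: closedness says that every edge uv of K has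
-- deg u + deg v ≥ n, and with s = k + t, a = n − s the edge bound says that the
-- degree sum P of K satisfies P + s² < 2sa + s. Let H be the vertices of K-degree
-- at least a and h = |H|. The other n − h vertices form a clique of G unless K has
-- an edge between two of them, and n − h ≥ a + 1 when h < s. Otherwise double counting
-- shows P + s² ≥ 2sa + s: if h ≥ s, the edges of K meeting H already force
-- 2ha + h ≤ P + h²; if h < s, pick u outside H of least positive degree x in
-- K − H, whose neighbours in K − H have degree at least x there and, because each
-- edge at u is heavy, at least a + s − x − 2h. Counting the edges meeting this
-- neighbourhood supplies the missing 2ca + c, c = s − h.

module Submission where

open import Defs renaming (sym to adj-sym)
open import Data.Nat using (ℕ; zero; suc; _+_; _*_; _∸_; _^_; _≤_; _<_; _≥_; z≤n; s≤s; _≤?_; _<?_)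
open import Data.Nat.Properties hiding (_≟_)
open import Data.Nat.Combinatorics using (_C_; nC1≡n; nCk+nC[k+1]≡[n+1]C[k+1])
open import Data.Nat.Tactic.RingSolver using (solve-∀; solve)
open import Data.Bool using (Bool; true; false; if_then_else_; not; _∧_; _∨_)
open import Data.Bool.Properties using (∧-comm; ∧-zeroʳ) renaming (_≟_ to _≟ᵇ_)
open import Data.Fin using (Fin; zero; suc; toℕ)
open import Data.Fin.Properties using (_≟_; toℕ-injective; any?)
import Relation.Unary as U
open import Data.List using ([]; _∷_; map; tabulate)
import Data.Nat.ListAction as List
import Data.Vec as Vec
open import Data.Vec.Properties using ([]=⇒lookup; lookup∘tabulate)
open import Data.Fin.Subset using (_∈_; ∣_∣)
open import Data.Product using (_×_; _,_; ∃; proj₁; proj₂)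
open import Function using (_∘_)
open import Relation.Binary.PropositionalEquality hiding ([_])
open import Relation.Nullary using (¬_; Dec; yes; no; does)
open import Relation.Nullary.Decidable using (⌊_⌋; dec-true; dec-false; _×-dec_)
open import Data.Empty using (⊥-elim)
open import Algebra.Properties.Semiring.Sum +-*-semiring
  using (sum; sum-syntax; ∑-distrib-+; ∑-comm; sum-cong-≗; *-distribˡ-sum)

private variable n : ℕ

-- Finite sums

[_] : Bool → ℕ
[ b ] = if b then 1 else 0

[b]≤1 : ∀ b → [ b ] ≤ 1
[b]≤1 true  = ≤-refl
[b]≤1 false = z≤n

[∧]≡[]*[] : ∀ a b → [ a ∧ b ] ≡ [ a ] * [ b ]
[∧]≡[]*[] true  b = sym (+-identityʳ [ b ])
[∧]≡[]*[] false b = refl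

sum-map-tabulate : ∀ {A : Set} (g : A → ℕ) (f : Fin n → A) →
                   List.sum (map g (tabulate f)) ≡ ∑[ i < n ] g (f i)
sum-map-tabulate {n = zero}  g f = refl
sum-map-tabulate {n = suc n} g f = cong (g (f zero) +_) (sum-map-tabulate g (f ∘ suc))

count≡∑ : ∀ (p : Fin n → Bool) → count p ≡ ∑[ i < n ] [ p i ]
count≡∑ p = sum-map-tabulate (λ i → [ p i ]) (λ i → i)

∣tabulate∣≡count : ∀ (X : Fin n → Bool) → ∣ Vec.tabulate X ∣ ≡ count X
∣tabulate∣≡count X = trans (∣tabulate∣≡∑ X) (sym (count≡∑ X))
  where
  ∣tabulate∣≡∑ : ∀ {m} (Y : Fin m → Bool) → ∣ Vec.tabulate Y ∣ ≡ ∑[ i < m ] [ Y i ]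
  ∣tabulate∣≡∑ {zero}  Y = refl
  ∣tabulate∣≡∑ {suc m} Y with Y zero
  ... | true  = cong suc (∣tabulate∣≡∑ (Y ∘ suc))
  ... | false = ∣tabulate∣≡∑ (Y ∘ suc)

∑-mono-≤ : {f g : Fin n → ℕ} → (∀ i → f i ≤ g i) → sum f ≤ sum g
∑-mono-≤ {zero}  f≤g = z≤n
∑-mono-≤ {suc n} f≤g = +-mono-≤ (f≤g zero) (∑-mono-≤ (f≤g ∘ suc))

∑-mono-< : {f g : Fin n → ℕ} → (∀ i → f i ≤ g i) → ∀ j → f j < g j → sum f < sum g
∑-mono-< f≤g zero    fj<gj = +-mono-<-≤ fj<gj (∑-mono-≤ (f≤g ∘ suc))
∑-mono-< f≤g (suc j) fj<gj = +-mono-≤-< (f≤g zero) (∑-mono-< (f≤g ∘ suc) j fj<gj)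

∑-const : ∀ n c → ∑[ i < n ] c ≡ n * c
∑-const zero    c = refl
∑-const (suc n) c = cong (c +_) (∑-const n c)

∑-*ʳ : ∀ (f : Fin n → ℕ) c → ∑[ i < n ] (f i * c) ≡ sum f * c
∑-*ʳ {n} f c = begin
  ∑[ i < n ] (f i * c) ≡⟨ sum-cong-≗ (λ i → *-comm (f i) c) ⟩
  ∑[ i < n ] (c * f i) ≡⟨ *-distribˡ-sum c f ⟨
  c * sum f            ≡⟨ *-comm c (sum f) ⟩
  sum f * c            ∎
  where open ≡-Reasoning

count-not+count : ∀ (H : Fin n → Bool) → count (not ∘ H) + count H ≡ n
count-not+count {n} H = begin
  count (not ∘ H) + count H                          ≡⟨ cong₂ _+_ (count≡∑ (not ∘ H)) (count≡∑ H) ⟩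
  ∑[ u < n ] [ not (H u) ] + ∑[ u < n ] [ H u ]      ≡⟨ ∑-distrib-+ (λ u → [ not (H u) ]) (λ u → [ H u ]) ⟨
  ∑[ u < n ] ([ not (H u) ] + [ H u ])               ≡⟨ sum-cong-≗ (λ u → [not]+[] (H u)) ⟩
  ∑[ u < n ] 1                                       ≡⟨ trans (∑-const n 1) (*-identityʳ n) ⟩
  n                                                  ∎
  where
  open ≡-Reasoning
  [not]+[] : ∀ b → [ not b ] + [ b ] ≡ 1
  [not]+[] true  = refl
  [not]+[] false = refl

∑∑-distrib-+ : ∀ (f g : Fin n → Fin n → ℕ) →
               ∑[ u < n ] ∑[ v < n ] (f u v + g u v) ≡
               ∑[ u < n ] ∑[ v < n ] f u v + ∑[ u < n ] ∑[ v < n ] g u v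
∑∑-distrib-+ {n} f g = begin
  ∑[ u < n ] ∑[ v < n ] (f u v + g u v)                       ≡⟨ sum-cong-≗ (λ u → ∑-distrib-+ (f u) (g u)) ⟩
  ∑[ u < n ] (∑[ v < n ] f u v + ∑[ v < n ] g u v)            ≡⟨ ∑-distrib-+ (λ u → sum (f u)) (λ u → sum (g u)) ⟩
  ∑[ u < n ] ∑[ v < n ] f u v + ∑[ u < n ] ∑[ v < n ] g u v   ∎
  where open ≡-Reasoning

∑count≡∑∑ : ∀ (p : Fin n → Fin n → Bool) →
            ∑[ u < n ] count (p u) ≡ ∑[ u < n ] ∑[ v < n ] [ p u v ]
∑count≡∑∑ p = sum-cong-≗ (λ u → count≡∑ (p u))

∑-[u≟v]≡1 : ∀ (u : Fin n) → ∑[ v < n ] [ does (u ≟ v) ] ≡ 1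
∑-[u≟v]≡1 {suc n} zero    = cong suc (trans (∑-const n 0) (*-zeroʳ n))
∑-[u≟v]≡1 {suc n} (suc u) = ∑-[u≟v]≡1 u

sumOver : (Fin n → Bool) → (Fin n → ℕ) → ℕ
sumOver {n} X g = ∑[ u < n ] ([ X u ] * g u)

count*≤sumOver+count* : ∀ (X : Fin n → Bool) (g : Fin n → ℕ) {b k} →
                        (∀ u → X u ≡ true → b ≤ g u + k) →
                        count X * b ≤ sumOver X g + count X * k
count*≤sumOver+count* {n} X g {b} {k} b≤g+k = begin
  count X * b                                    ≡⟨ cong (_* b) (count≡∑ X) ⟩
  sum (λ u → [ X u ]) * b                        ≡⟨ ∑-*ʳ (λ u → [ X u ]) b ⟨
  ∑[ u < n ] ([ X u ] * b)                       ≤⟨ ∑-mono-≤ pointwise ⟩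
  ∑[ u < n ] ([ X u ] * g u + [ X u ] * k)       ≡⟨ ∑-distrib-+ (λ u → [ X u ] * g u) (λ u → [ X u ] * k) ⟩
  sumOver X g + ∑[ u < n ] ([ X u ] * k)         ≡⟨ cong (sumOver X g +_) (∑-*ʳ (λ u → [ X u ]) k) ⟩
  sumOver X g + sum (λ u → [ X u ]) * k          ≡⟨ cong (λ m → sumOver X g + m * k) (count≡∑ X) ⟨
  sumOver X g + count X * k                      ∎
  where
  open ≤-Reasoning
  pointwise : ∀ u → [ X u ] * b ≤ [ X u ] * g u + [ X u ] * k
  pointwise u with X u in Xu
  ... | true  = ≤-trans (+-monoˡ-≤ 0 (b≤g+k u Xu)) (≤-reflexive (*-distribˡ-+ 1 (g u) k))
  ... | false = z≤n

count*≤sumOver : ∀ (X : Fin n → Bool) (g : Fin n → ℕ) {b} →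
                 (∀ u → X u ≡ true → b ≤ g u) → count X * b ≤ sumOver X g
count*≤sumOver X g {b} b≤g = begin
  count X * b                    ≤⟨ count*≤sumOver+count* X g {k = 0} (λ u Xu → ≤-trans (b≤g u Xu) (m≤m+n (g u) 0)) ⟩
  sumOver X g + count X * 0      ≡⟨ cong (sumOver X g +_) (*-zeroʳ (count X)) ⟩
  sumOver X g + 0                ≡⟨ +-identityʳ (sumOver X g) ⟩
  sumOver X g                    ∎
  where open ≤-Reasoning

does-true⇒ : ∀ {A : Set} (a? : Dec A) → does a? ≡ true → A
does-true⇒ (yes a) _ = a

does-false⇒¬ : ∀ {A : Set} (a? : Dec A) → does a? ≡ false → ¬ A
does-false⇒¬ (no ¬a) _ = ¬a

minimiser : ∀ {p} {P : Fin n → Set p} → U.Decidable P → (g : Fin n → ℕ) → ∃ P →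
            ∃ λ w → P w × (∀ v → P v → g w ≤ g v)
minimiser {n} {P = P} P? g (u , Pu) = descend (g u) u ≤-refl Pu
  where
  descend : ∀ b u → g u ≤ b → P u → ∃ λ w → P w × (∀ v → P v → g w ≤ g v)
  descend zero    u gu≤0 Pu = u , Pu , λ v _ → ≤-trans gu≤0 z≤n
  descend (suc b) u gu≤b Pu with any? (λ v → P? v ×-dec g v <? g u)
  ... | yes (v , Pv , gv<gu) = descend b v (≤-pred (≤-trans gv<gu gu≤b)) Pv
  ... | no ¬smaller          = u , Pu , λ v Pv → ≮⇒≥ (λ gv<gu → ¬smaller (v , Pv , gv<gu))

-- Graphs

arcs : Graph n → ℕ
arcs {n} K = ∑[ u < n ] deg K u

arcsTouching : Graph n → (Fin n → Bool) → ℕ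
arcsTouching {n} K X = ∑[ u < n ] count (λ v → adj K u v ∧ (X u ∨ X v))

IsIndependent : Graph n → (Fin n → Bool) → Set
IsIndependent K X = ∀ u v → X u ≡ true → X v ≡ true → ¬ Adj K u v

HasHeavyEdges : ℕ → Graph n → Set
HasHeavyEdges l K = ∀ u v → Adj K u v → l ≤ deg K u + deg K v

HasNeighbour : Graph n → Fin n → Set
HasNeighbour K u = ∃ λ v → Adj K u v

hasNeighbour? : ∀ (K : Graph n) → U.Decidable (HasNeighbour K)
hasNeighbour? K u = any? (λ v → adj K u v ≟ᵇ true)

does-≟-sym : ∀ (u v : Fin n) → does (u ≟ v) ≡ does (v ≟ u)
does-≟-sym u v with u ≟ v | v ≟ u
... | yes _    | yes _    = refl
... | no _     | no _     = refl
... | yes refl | no v≢u   = ⊥-elim (v≢u refl)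
... | no u≢v   | yes refl = ⊥-elim (u≢v refl)

complement : Graph n → Graph n
complement G = record
  { adj    = λ u v → not (does (u ≟ v)) ∧ not (adj G u v)
  ; sym    = λ u v → cong₂ (λ e a → not e ∧ not a) (does-≟-sym u v) (adj-sym G u v)
  ; irrefl = λ u → cong (λ e → not e ∧ not (adj G u u)) (dec-true (u ≟ u) refl)
  }

_∖_ : Graph n → (Fin n → Bool) → Graph n
K ∖ H = record
  { adj    = λ u v → adj K u v ∧ (not (H u) ∧ not (H v))
  ; sym    = λ u v → cong₂ _∧_ (adj-sym K u v) (∧-comm (not (H u)) (not (H v)))
  ; irrefl = λ u → cong (_∧ (not (H u) ∧ not (H u))) (irrefl K u)
  }

handshake : ∀ (G : Graph n) → 2 * edges G ≡ arcs G
handshake {n} G = begin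
  2 * edges G                                  ≡⟨ cong (2 *_) edges≡∑∑ ⟩
  2 * L                                        ≡⟨ cong (L +_) (+-identityʳ L) ⟩
  L + L                                        ≡⟨ cong (L +_) (∑-comm (λ u v → [ lt u v ∧ adj G u v ])) ⟩
  L + ∑[ u < n ] ∑[ v < n ] [ lt v u ∧ adj G v u ] ≡⟨ ∑∑-distrib-+ (λ u v → [ lt u v ∧ adj G u v ]) (λ u v → [ lt v u ∧ adj G v u ]) ⟨
  ∑[ u < n ] ∑[ v < n ] ([ lt u v ∧ adj G u v ] + [ lt v u ∧ adj G v u ])
                                               ≡⟨ sum-cong-≗ (λ u → sum-cong-≗ (λ v → split u v)) ⟨
  ∑[ u < n ] ∑[ v < n ] [ adj G u v ]          ≡⟨ ∑count≡∑∑ (adj G) ⟨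
  arcs G                                       ∎
  where
  open ≡-Reasoning
  lt : Fin n → Fin n → Bool
  lt u v = ⌊ toℕ u <? toℕ v ⌋
  L : ℕ
  L = ∑[ u < n ] ∑[ v < n ] [ lt u v ∧ adj G u v ]
  edges≡∑∑ : edges G ≡ L
  edges≡∑∑ = trans (sum-map-tabulate (λ u → count (λ v → lt u v ∧ adj G u v)) (λ u → u))
                   (∑count≡∑∑ (λ u v → lt u v ∧ adj G u v))
  split : ∀ u v → [ adj G u v ] ≡ [ lt u v ∧ adj G u v ] + [ lt v u ∧ adj G v u ]
  split u v with toℕ u <? toℕ v | toℕ v <? toℕ u
  ... | yes u<v | yes v<u = ⊥-elim (<-asym u<v v<u)
  ... | yes _   | no _    = sym (+-identityʳ _)
  ... | no _    | yes _   = cong [_] (adj-sym G u v)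
  ... | no u≮v  | no v≮u with toℕ-injective (≤-antisym (≮⇒≥ v≮u) (≮⇒≥ u≮v))
  ...   | refl = cong [_] (irrefl G u)

module _ (G : Graph n) where

  private
    Ḡ : Graph n
    Ḡ = complement G

  deg+deg-complement : ∀ u → deg G u + deg Ḡ u + 1 ≡ n
  deg+deg-complement u = begin
    deg G u + deg Ḡ u + 1
      ≡⟨ cong₂ (λ x y → x + y + 1) (count≡∑ (adj G u)) (count≡∑ (adj Ḡ u)) ⟩
    ∑[ v < n ] [ adj G u v ] + ∑[ v < n ] [ adj Ḡ u v ] + 1
      ≡⟨ cong (∑[ v < n ] [ adj G u v ] + ∑[ v < n ] [ adj Ḡ u v ] +_) (∑-[u≟v]≡1 u) ⟨
    ∑[ v < n ] [ adj G u v ] + ∑[ v < n ] [ adj Ḡ u v ] + ∑[ v < n ] [ does (u ≟ v) ]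
      ≡⟨ cong (_+ ∑[ v < n ] [ does (u ≟ v) ]) (∑-distrib-+ (λ v → [ adj G u v ]) (λ v → [ adj Ḡ u v ])) ⟨
    ∑[ v < n ] ([ adj G u v ] + [ adj Ḡ u v ]) + ∑[ v < n ] [ does (u ≟ v) ]
      ≡⟨ ∑-distrib-+ (λ v → [ adj G u v ] + [ adj Ḡ u v ]) (λ v → [ does (u ≟ v) ]) ⟨
    ∑[ v < n ] ([ adj G u v ] + [ adj Ḡ u v ] + [ does (u ≟ v) ])
      ≡⟨ sum-cong-≗ partition ⟩
    ∑[ v < n ] 1
      ≡⟨ trans (∑-const n 1) (*-identityʳ n) ⟩
    n ∎
    where
    open ≡-Reasoning
    partition : ∀ v → [ adj G u v ] + [ adj Ḡ u v ] + [ does (u ≟ v) ] ≡ 1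
    partition v with u ≟ v
    ... | yes refl rewrite irrefl G u = refl
    ... | no _ with adj G u v
    ...   | true  = refl
    ...   | false = refl

  arcs+arcs-complement : arcs G + arcs Ḡ + n ≡ n * n
  arcs+arcs-complement = begin
    arcs G + arcs Ḡ + n                   ≡⟨ cong (arcs G + arcs Ḡ +_) (trans (∑-const n 1) (*-identityʳ n)) ⟨
    arcs G + arcs Ḡ + ∑[ u < n ] 1        ≡⟨ cong (_+ ∑[ u < n ] 1) (∑-distrib-+ (deg G) (deg Ḡ)) ⟨
    ∑[ u < n ] (deg G u + deg Ḡ u) + ∑[ u < n ] 1
                                          ≡⟨ ∑-distrib-+ (λ u → deg G u + deg Ḡ u) (λ _ → 1) ⟨
    ∑[ u < n ] (deg G u + deg Ḡ u + 1)    ≡⟨ sum-cong-≗ deg+deg-complement ⟩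
    ∑[ u < n ] n                          ≡⟨ ∑-const n n ⟩
    n * n                                 ∎
    where open ≡-Reasoning

  adj-complement : ∀ {u v} → Adj Ḡ u v → u ≢ v × ¬ Adj G u v
  adj-complement {u} {v} Ḡuv with u ≟ v | adj G u v
  ... | no u≢v | false = u≢v , λ ()
  adj-complement () | yes _ | _
  adj-complement () | no _  | true

  closed⇒complement-heavy : IsClosed (n ∸ 1) G → HasHeavyEdges n Ḡ
  closed⇒complement-heavy closed u v Ḡuv = +-cancelʳ-≤ (deg G u + deg G v + 2) n _ (begin
    n + (deg G u + deg G v + 2)                       ≤⟨ +-monoʳ-≤ n (+2≤ (closed u v u≢v ¬Guv)) ⟩
    n + n                                             ≡⟨ cong₂ _+_ (deg+deg-complement u) (deg+deg-complement v) ⟨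
    deg G u + deg Ḡ u + 1 + (deg G v + deg Ḡ v + 1)   ≡⟨ regroup (deg G u) (deg Ḡ u) (deg G v) (deg Ḡ v) ⟩
    deg Ḡ u + deg Ḡ v + (deg G u + deg G v + 2)       ∎)
    where
    open ≤-Reasoning
    u≢v : u ≢ v
    u≢v = proj₁ (adj-complement Ḡuv)
    ¬Guv : ¬ Adj G u v
    ¬Guv = proj₂ (adj-complement Ḡuv)
    regroup : ∀ a b c d → a + b + 1 + (c + d + 1) ≡ b + d + (a + c + 2)
    regroup = solve-∀
    +2≤ : ∀ {m l} → m < l ∸ 1 → m + 2 ≤ l
    +2≤ {m} {suc l} m<l = subst (_≤ suc l) (+-comm 2 m) (s≤s m<l)

  independent-complement⇒clique : ∀ {X} → IsIndependent Ḡ X → IsClique G (Vec.tabulate X)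
  independent-complement⇒clique {X} independent u v u∈ v∈ u≢v with adj G u v in Guv
  ... | true  = refl
  ... | false = ⊥-elim (independent u v (∈-tabulate u∈) (∈-tabulate v∈) Ḡuv)
    where
    ∈-tabulate : ∀ {w} → w ∈ Vec.tabulate X → X w ≡ true
    ∈-tabulate {w} w∈ = trans (sym (lookup∘tabulate X w)) ([]=⇒lookup w∈)
    Ḡuv : Adj Ḡ u v
    Ḡuv rewrite dec-false (u ≟ v) u≢v | Guv = refl

module _ (K : Graph n) where

  sumOver-deg : ∀ X → sumOver X (deg K) ≡ ∑[ u < n ] ∑[ v < n ] [ adj K u v ∧ X u ]
  sumOver-deg X = sum-cong-≗ λ u → begin
    [ X u ] * deg K u                        ≡⟨ cong ([ X u ] *_) (count≡∑ (adj K u)) ⟩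
    [ X u ] * ∑[ v < n ] [ adj K u v ]       ≡⟨ *-distribˡ-sum [ X u ] (λ v → [ adj K u v ]) ⟩
    ∑[ v < n ] ([ X u ] * [ adj K u v ])     ≡⟨ sum-cong-≗ (λ v → trans (*-comm [ X u ] _) (sym ([∧]≡[]*[] (adj K u v) (X u)))) ⟩
    ∑[ v < n ] [ adj K u v ∧ X u ]           ∎
    where open ≡-Reasoning

  sumOver-deg′ : ∀ X → sumOver X (deg K) ≡ ∑[ u < n ] ∑[ v < n ] [ adj K u v ∧ X v ]
  sumOver-deg′ X = trans (sumOver-deg X) (trans (∑-comm (λ u v → [ adj K u v ∧ X u ]))
    (sum-cong-≗ λ u → sum-cong-≗ λ v → cong (λ b → [ b ∧ X v ]) (adj-sym K v u)))

  sumOver-deg≤arcs : ∀ X → sumOver X (deg K) ≤ arcs K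
  sumOver-deg≤arcs X = ∑-mono-≤ λ u → ≤-trans (*-monoˡ-≤ (deg K u) ([b]≤1 (X u))) (≤-reflexive (+-identityʳ (deg K u)))

  arcsWithin+count≤count² : ∀ X →
    ∑[ u < n ] ∑[ v < n ] [ adj K u v ∧ (X u ∧ X v) ] + count X ≤ count X * count X
  arcsWithin+count≤count² X = begin
    ∑[ u < n ] ∑[ v < n ] [ adj K u v ∧ (X u ∧ X v) ] + count X
      ≡⟨ cong (∑[ u < n ] ∑[ v < n ] [ adj K u v ∧ (X u ∧ X v) ] +_) (count≡∑ X) ⟩
    ∑[ u < n ] ∑[ v < n ] [ adj K u v ∧ (X u ∧ X v) ] + ∑[ u < n ] [ X u ]
      ≡⟨ ∑-distrib-+ (λ u → ∑[ v < n ] [ adj K u v ∧ (X u ∧ X v) ]) (λ u → [ X u ]) ⟨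
    ∑[ u < n ] (∑[ v < n ] [ adj K u v ∧ (X u ∧ X v) ] + [ X u ])
      ≤⟨ ∑-mono-≤ row ⟩
    ∑[ u < n ] ([ X u ] * count X)
      ≡⟨ ∑-*ʳ (λ u → [ X u ]) (count X) ⟩
    ∑[ u < n ] [ X u ] * count X
      ≡⟨ cong (_* count X) (count≡∑ X) ⟨
    count X * count X ∎
    where
    open ≤-Reasoning
    row : ∀ u → ∑[ v < n ] [ adj K u v ∧ (X u ∧ X v) ] + [ X u ] ≤ [ X u ] * count X
    row u with X u in Xu
    ... | false = begin
      ∑[ v < n ] [ adj K u v ∧ false ] + 0  ≡⟨ +-identityʳ _ ⟩
      ∑[ v < n ] [ adj K u v ∧ false ]      ≡⟨ sum-cong-≗ (λ v → cong [_] (∧-zeroʳ (adj K u v))) ⟩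
      ∑[ v < n ] 0                          ≡⟨ trans (∑-const n 0) (*-zeroʳ n) ⟩
      0                                     ∎
    ... | true  = begin
      ∑[ v < n ] [ adj K u v ∧ X v ] + 1    ≡⟨ +-comm _ 1 ⟩
      suc (∑[ v < n ] [ adj K u v ∧ X v ])  ≤⟨ ∑-mono-< within u self-loop-free ⟩
      ∑[ v < n ] [ X v ]                    ≡⟨ count≡∑ X ⟨
      count X                               ≡⟨ +-identityʳ (count X) ⟨
      count X + 0                           ∎
      where
      within : ∀ v → [ adj K u v ∧ X v ] ≤ [ X v ]
      within v with adj K u v
      ... | true  = ≤-refl
      ... | false = z≤n
      self-loop-free : [ adj K u u ∧ X u ] < [ X u ]
      self-loop-free rewrite Xu | irrefl K u = ≤-refl

  -- An arc with both ends in X is counted twice on the left, and there are at most |X|² − |X| of them.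
  twice-sumOver-deg≤arcsTouching : ∀ X →
    2 * sumOver X (deg K) + count X ≤ arcsTouching K X + count X * count X
  twice-sumOver-deg≤arcsTouching X = begin
    2 * T + m                                   ≡⟨ cong (λ t → T + t + m) (+-identityʳ T) ⟩
    T + T + m                                   ≡⟨ cong (_+ m) (cong₂ _+_ (sumOver-deg X) (sumOver-deg′ X)) ⟩
    ∑∑ from + ∑∑ into + m                       ≡⟨ cong (_+ m) (∑∑-distrib-+ from into) ⟨
    ∑∑ (λ u v → from u v + into u v) + m        ≡⟨ cong (_+ m) (sum-cong-≗ λ u → sum-cong-≗ λ v →
                                                     inclusion-exclusion (adj K u v) (X u) (X v)) ⟩
    ∑∑ (λ u v → touching u v + within u v) + m  ≡⟨ cong (_+ m) (∑∑-distrib-+ touching within) ⟩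
    ∑∑ touching + ∑∑ within + m                 ≡⟨ +-assoc (∑∑ touching) (∑∑ within) m ⟩
    ∑∑ touching + (∑∑ within + m)               ≤⟨ +-monoʳ-≤ (∑∑ touching) (arcsWithin+count≤count² X) ⟩
    ∑∑ touching + m * m                         ≡⟨ cong (_+ m * m) (∑count≡∑∑ (λ u v → adj K u v ∧ (X u ∨ X v))) ⟨
    arcsTouching K X + m * m                    ∎
    where
    open ≤-Reasoning
    T m : ℕ
    T = sumOver X (deg K)
    m = count X
    ∑∑ : (Fin n → Fin n → ℕ) → ℕ
    ∑∑ f = ∑[ u < n ] ∑[ v < n ] f u v
    from into touching within : Fin n → Fin n → ℕ
    from     u v = [ adj K u v ∧ X u ]
    into     u v = [ adj K u v ∧ X v ]
    touching u v = [ adj K u v ∧ (X u ∨ X v) ]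
    within   u v = [ adj K u v ∧ (X u ∧ X v) ]
    inclusion-exclusion : ∀ c a b → [ c ∧ a ] + [ c ∧ b ] ≡ [ c ∧ (a ∨ b) ] + [ c ∧ (a ∧ b) ]
    inclusion-exclusion false a     b = refl
    inclusion-exclusion true  true  b = refl
    inclusion-exclusion true  false b = sym (+-identityʳ [ b ])

  arcsTouching+arcsTouching-∖≤arcs : ∀ H Y → arcsTouching K H + arcsTouching (K ∖ H) Y ≤ arcs K
  arcsTouching+arcsTouching-∖≤arcs H Y = begin
    arcsTouching K H + arcsTouching (K ∖ H) Y
      ≡⟨ cong₂ _+_ (∑count≡∑∑ (λ u v → adj K u v ∧ (H u ∨ H v))) (∑count≡∑∑ (λ u v → adj (K ∖ H) u v ∧ (Y u ∨ Y v))) ⟩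
    ∑[ u < n ] ∑[ v < n ] [ adj K u v ∧ (H u ∨ H v) ] + ∑[ u < n ] ∑[ v < n ] [ adj (K ∖ H) u v ∧ (Y u ∨ Y v) ]
      ≡⟨ ∑∑-distrib-+ (λ u v → [ adj K u v ∧ (H u ∨ H v) ]) (λ u v → [ adj (K ∖ H) u v ∧ (Y u ∨ Y v) ]) ⟨
    ∑[ u < n ] ∑[ v < n ] ([ adj K u v ∧ (H u ∨ H v) ] + [ adj (K ∖ H) u v ∧ (Y u ∨ Y v) ])
      ≤⟨ ∑-mono-≤ (λ u → ∑-mono-≤ λ v → disjoint (adj K u v) (H u) (H v) (Y u ∨ Y v)) ⟩
    ∑[ u < n ] ∑[ v < n ] [ adj K u v ]
      ≡⟨ ∑count≡∑∑ (adj K) ⟨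
    arcs K ∎
    where
    open ≤-Reasoning
    disjoint : ∀ c a b y → [ c ∧ (a ∨ b) ] + [ (c ∧ (not a ∧ not b)) ∧ y ] ≤ [ c ]
    disjoint false _     _     _ = z≤n
    disjoint true  true  _     _ = ≤-refl
    disjoint true  false true  _ = ≤-refl
    disjoint true  false false y = [b]≤1 y

  module _ (H : Fin n → Bool) where

    adj-∖ : ∀ {u v} → Adj (K ∖ H) u v → Adj K u v × H u ≡ false × H v ≡ false
    adj-∖ {u} {v} K∖Huv with adj K u v | H u | H v
    ... | true | false | false = refl , refl , refl
    adj-∖ () | false | _     | _
    adj-∖ () | true  | true  | _
    adj-∖ () | true  | false | true

    deg≤deg-∖+count : ∀ {u} → H u ≡ false → deg K u ≤ deg (K ∖ H) u + count H
    deg≤deg-∖+count {u} Hu = begin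
      deg K u                                                  ≡⟨ count≡∑ (adj K u) ⟩
      ∑[ v < n ] [ adj K u v ]                                 ≤⟨ ∑-mono-≤ pointwise ⟩
      ∑[ v < n ] ([ adj (K ∖ H) u v ] + [ H v ])               ≡⟨ ∑-distrib-+ (λ v → [ adj (K ∖ H) u v ]) (λ v → [ H v ]) ⟩
      ∑[ v < n ] [ adj (K ∖ H) u v ] + ∑[ v < n ] [ H v ]      ≡⟨ cong₂ _+_ (count≡∑ (adj (K ∖ H) u)) (count≡∑ H) ⟨
      deg (K ∖ H) u + count H                                  ∎
      where
      open ≤-Reasoning
      pointwise : ∀ v → [ adj K u v ] ≤ [ adj (K ∖ H) u v ] + [ H v ]
      pointwise v rewrite Hu with adj K u v | H v
      ... | true  | true  = ≤-refl
      ... | true  | false = ≤-refl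
      ... | false | _     = z≤n

    edgeless-∖⇒independent : (∀ u v → ¬ Adj (K ∖ H) u v) → IsIndependent K (not ∘ H)
    edgeless-∖⇒independent edgeless u v ¬Hu ¬Hv Kuv = edgeless u v K∖Huv
      where
      K∖Huv : Adj (K ∖ H) u v
      K∖Huv rewrite Kuv | ¬Hu | ¬Hv = refl

-- Arithmetic

≤-offset : ∀ {m n} k → m + k ≡ n → m ≤ n
≤-offset {m} k refl = m≤m+n m k

n≤n*n : ∀ n → n ≤ n * n
n≤n*n zero    = z≤n
n≤n*n (suc n) = m≤m*n (suc n) (suc n)

many-high-bound : ∀ {s h a P} → s ≤ h → 3 * s ≤ 2 * a + 1 → h * a ≤ P → 2 * (h * a) + h ≤ P + h * h →
                  2 * (s * a) + s ≤ P + s * s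
many-high-bound {s} {h} {a} {P} s≤h 3s≤ ha≤P bound with 2 * s ≤? h
... | yes 2s≤h = +-mono-≤ (begin
  2 * (s * a) ≡⟨ *-assoc 2 s a ⟨
  2 * s * a   ≤⟨ *-monoˡ-≤ a 2s≤h ⟩
  h * a       ≤⟨ ha≤P ⟩
  P           ∎) (n≤n*n s)
  where open ≤-Reasoning
... | no 2s≰h with h ∸ s | m+[n∸m]≡n s≤h
...   | y | refl = +-cancelʳ-≤ ((s + y) * (s + y) + y * (2 * a + 1)) _ _ (begin
  2 * (s * a) + s + ((s + y) * (s + y) + y * (2 * a + 1))
    ≡⟨ solve (s ∷ y ∷ a ∷ []) ⟩
  2 * ((s + y) * a) + (s + y) + s * s + y * (2 * s + y)
    ≤⟨ +-mono-≤ (+-monoˡ-≤ (s * s) bound) (*-monoʳ-≤ y 2s+y≤2a+1) ⟩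
  P + (s + y) * (s + y) + s * s + y * (2 * a + 1)
    ≡⟨ solve (s ∷ y ∷ a ∷ P ∷ []) ⟩
  P + s * s + ((s + y) * (s + y) + y * (2 * a + 1)) ∎)
  where
  open ≤-Reasoning
  y≤s : y ≤ s
  y≤s = <⇒≤ (+-cancelˡ-< s y s (subst (s + y <_) (cong (s +_) (+-identityʳ s)) (≰⇒> 2s≰h)))
  2s+y≤2a+1 : 2 * s + y ≤ 2 * a + 1
  2s+y≤2a+1 = begin
    2 * s + y ≤⟨ +-monoʳ-≤ (2 * s) y≤s ⟩
    2 * s + s ≡⟨ solve (s ∷ []) ⟩
    3 * s     ≤⟨ 3s≤ ⟩
    2 * a + 1 ∎

remainder-bound-small : ∀ {h c a x S Σ} →
  5 * (h + c) ≤ a + 1 → c ≤ x → 2 * x + h ≤ c + a →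
  2 * Σ + x ≤ S + x * x → x * (h + c + a) ≤ Σ + x * (2 * h + x) →
  2 * (c * a) + c ≤ S + 2 * (h * c) + c * c
remainder-bound-small {h} {c} {a} {x} {S} {Σ} five c≤x small cov lower with x ∸ c | m+[n∸m]≡n c≤x
... | z | refl = +-cancelʳ-≤ (x * x + 2 * (x * (2 * h + x)) + z * (2 * a + 1)) _ _ (begin
  2 * (c * a) + c + (x * x + 2 * (x * (2 * h + x)) + z * (2 * a + 1))
    ≡⟨ solve (h ∷ c ∷ a ∷ z ∷ []) ⟩
  2 * (h * c) + c * c + (2 * (x * (h + c + a)) + x) + z * (2 * h + 4 * c + 3 * z)
    ≤⟨ +-mono-≤ (+-monoʳ-≤ (2 * (h * c) + c * c) (+-monoˡ-≤ x (*-monoʳ-≤ 2 lower))) (*-monoʳ-≤ z rest) ⟩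
  2 * (h * c) + c * c + (2 * (Σ + x * (2 * h + x)) + x) + z * (2 * a + 1)
    ≡⟨ solve (h ∷ c ∷ a ∷ z ∷ Σ ∷ []) ⟩
  2 * (h * c) + c * c + (2 * Σ + x) + (2 * (x * (2 * h + x)) + z * (2 * a + 1))
    ≤⟨ +-monoˡ-≤ (2 * (x * (2 * h + x)) + z * (2 * a + 1)) (+-monoʳ-≤ (2 * (h * c) + c * c) cov) ⟩
  2 * (h * c) + c * c + (S + x * x) + (2 * (x * (2 * h + x)) + z * (2 * a + 1))
    ≡⟨ solve (h ∷ c ∷ a ∷ z ∷ S ∷ []) ⟩
  S + 2 * (h * c) + c * c + (x * x + 2 * (x * (2 * h + x)) + z * (2 * a + 1)) ∎)
  where
  open ≤-Reasoning
  rest : 2 * h + 4 * c + 3 * z ≤ 2 * a + 1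
  rest = *-cancelˡ-≤ 2 (begin
    2 * (2 * h + 4 * c + 3 * z)         ≤⟨ ≤-offset (4 * h) (solve (h ∷ c ∷ z ∷ [])) ⟩
    3 * (c + 2 * z + h) + 5 * (h + c)   ≤⟨ +-mono-≤ (*-monoʳ-≤ 3 c+2z+h≤a) five ⟩
    3 * a + (a + 1)                     ≤⟨ ≤-offset 1 (solve (a ∷ [])) ⟩
    2 * (2 * a + 1)                     ∎)
    where
    c+2z+h≤a : c + 2 * z + h ≤ a
    c+2z+h≤a = +-cancelˡ-≤ c _ _ (begin
      c + (c + 2 * z + h)   ≡⟨ solve (c ∷ z ∷ h ∷ []) ⟩
      2 * (c + z) + h       ≤⟨ small ⟩
      c + a                 ∎)

-- (Q − 2c)(Q − 6c) ≥ 0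
8cQ≤Q²+12c² : ∀ {c Q} → 6 * c ≤ Q → 8 * c * Q ≤ Q * Q + 12 * (c * c)
8cQ≤Q²+12c² {c} {Q} 6c≤Q with Q ∸ 6 * c | m+[n∸m]≡n 6c≤Q
... | w | refl = ≤-offset (4 * c * w + w * w) (solve (c ∷ w ∷ []))

remainder-bound-large-core : ∀ {h c a x Q} → h + Q ≡ c + a + 1 → 6 * c ≤ Q → Q ≤ 2 * x →
                             2 * (c * a) + c ≤ x * x + x + (2 * (h * c) + c * c)
remainder-bound-large-core {h} {c} {a} {x} {Q} h+Q≡c+a+1 6c≤Q Q≤2x =
  *-cancelˡ-≤ 4 (+-cancelʳ-≤ (8 * (c * (c + 1))) _ _ (begin
    4 * (2 * (c * a) + c) + 8 * (c * (c + 1))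
      ≡⟨ solve (c ∷ a ∷ []) ⟩
    8 * c * (c + a + 1) + 4 * c
      ≡⟨ cong (λ t → 8 * c * t + 4 * c) h+Q≡c+a+1 ⟨
    8 * c * (h + Q) + 4 * c
      ≡⟨ cong (_+ 4 * c) (*-distribˡ-+ (8 * c) h Q) ⟩
    8 * c * h + 8 * c * Q + 4 * c
      ≤⟨ +-monoˡ-≤ (4 * c) (+-monoʳ-≤ (8 * c * h) (8cQ≤Q²+12c² {c} 6c≤Q)) ⟩
    8 * c * h + (Q * Q + 12 * (c * c)) + 4 * c
      ≤⟨ ≤-offset (2 * Q + 4 * c) (solve (c ∷ h ∷ Q ∷ [])) ⟩
    Q * Q + 2 * Q + 4 * (2 * (h * c) + c * c) + 8 * (c * (c + 1))
      ≤⟨ +-monoˡ-≤ (8 * (c * (c + 1))) (+-monoˡ-≤ (4 * (2 * (h * c) + c * c)) (+-mono-≤ (*-mono-≤ Q≤2x Q≤2x) (*-monoʳ-≤ 2 Q≤2x))) ⟩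
    2 * x * (2 * x) + 2 * (2 * x) + 4 * (2 * (h * c) + c * c) + 8 * (c * (c + 1))
      ≡⟨ solve (x ∷ h ∷ c ∷ []) ⟩
    4 * (x * x + x + (2 * (h * c) + c * c)) + 8 * (c * (c + 1)) ∎))
  where open ≤-Reasoning

remainder-bound-large : ∀ {h c a x S Σ} →
  5 * (h + c) ≤ a + 1 → c + a + 1 ≤ 2 * x + h →
  2 * Σ + x ≤ S + x * x → x * x ≤ Σ →
  2 * (c * a) + c ≤ S + 2 * (h * c) + c * c
remainder-bound-large {h} {c} {a} {x} {S} {Σ} five large cov x²≤Σ = begin
  2 * (c * a) + c                     ≤⟨ remainder-bound-large-core {h} {c} {a} {x} h+Q≡c+a+1 6c≤Q Q≤2x ⟩
  x * x + x + (2 * (h * c) + c * c)   ≤⟨ +-monoˡ-≤ (2 * (h * c) + c * c) x²+x≤S ⟩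
  S + (2 * (h * c) + c * c)           ≡⟨ +-assoc S (2 * (h * c)) (c * c) ⟨
  S + 2 * (h * c) + c * c             ∎
  where
  open ≤-Reasoning
  h≤c+a+1 : h ≤ c + a + 1
  h≤c+a+1 = begin
    h              ≤⟨ ≤-offset (4 * h + 5 * c) (solve (h ∷ c ∷ [])) ⟩
    5 * (h + c)    ≤⟨ five ⟩
    a + 1          ≤⟨ m≤n+m (a + 1) c ⟩
    c + (a + 1)    ≡⟨ +-assoc c a 1 ⟨
    c + a + 1      ∎
  Q : ℕ
  Q = c + a + 1 ∸ h
  h+Q≡c+a+1 : h + Q ≡ c + a + 1
  h+Q≡c+a+1 = m+[n∸m]≡n h≤c+a+1
  6c≤Q : 6 * c ≤ Q
  6c≤Q = +-cancelˡ-≤ h _ _ (begin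
    h + 6 * c              ≤⟨ ≤-offset (4 * h) (solve (h ∷ c ∷ [])) ⟩
    5 * (h + c) + c        ≤⟨ +-monoˡ-≤ c five ⟩
    a + 1 + c              ≡⟨ solve (a ∷ c ∷ []) ⟩
    c + a + 1              ≡⟨ h+Q≡c+a+1 ⟨
    h + Q                  ∎)
  Q≤2x : Q ≤ 2 * x
  Q≤2x = +-cancelˡ-≤ h _ _ (begin
    h + Q             ≡⟨ h+Q≡c+a+1 ⟩
    c + a + 1         ≤⟨ large ⟩
    2 * x + h         ≡⟨ +-comm (2 * x) h ⟩
    h + 2 * x         ∎)
  x²+x≤S : x * x + x ≤ S
  x²+x≤S = +-cancelʳ-≤ (x * x) _ _ (begin
    x * x + x + x * x   ≡⟨ solve (x ∷ []) ⟩
    2 * (x * x) + x     ≤⟨ +-monoˡ-≤ x (*-monoʳ-≤ 2 x²≤Σ) ⟩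
    2 * Σ + x           ≤⟨ cov ⟩
    S + x * x           ∎)

few-high-bound : ∀ {h c a x P S₁ S₂ Σ} →
  5 * (h + c) ≤ a + 1 → c ≤ x → S₁ + S₂ ≤ P → 2 * (h * a) + h ≤ S₁ + h * h →
  2 * Σ + x ≤ S₂ + x * x → x * x ≤ Σ → x * (h + c + a) ≤ Σ + x * (2 * h + x) →
  2 * ((h + c) * a) + (h + c) ≤ P + (h + c) * (h + c)
few-high-bound {h} {c} {a} {x} {P} {S₁} {S₂} five c≤x S₁+S₂≤P high cov x²≤Σ lower = begin
  2 * ((h + c) * a) + (h + c)                  ≡⟨ solve (h ∷ c ∷ a ∷ []) ⟩
  (2 * (h * a) + h) + (2 * (c * a) + c)        ≤⟨ +-mono-≤ high remainder ⟩
  (S₁ + h * h) + (S₂ + 2 * (h * c) + c * c)    ≡⟨ solve (S₁ ∷ S₂ ∷ h ∷ c ∷ []) ⟩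
  (S₁ + S₂) + (h + c) * (h + c)                ≤⟨ +-monoˡ-≤ ((h + c) * (h + c)) S₁+S₂≤P ⟩
  P + (h + c) * (h + c)                        ∎
  where
  open ≤-Reasoning
  remainder : 2 * (c * a) + c ≤ S₂ + 2 * (h * c) + c * c
  remainder with 2 * x + h ≤? c + a
  ... | yes small = remainder-bound-small five c≤x small cov lower
  ... | no ¬small = remainder-bound-large five (subst (_≤ 2 * x + h) (+-comm 1 (c + a)) (≰⇒> ¬small)) cov x²≤Σ

complement-arcs-bound : ∀ {s a e P} → 1 ≤ s → e + P + (s + a) ≡ (s + a) * (s + a) →
  a * a + 2 * ((s ∸ 1) * (s ∸ 1)) + 2 * s ≤ e + a → P + s * s < 2 * (s * a) + s
complement-arcs-bound {suc r} {a} {e} {P} _ e+P+n≡n² e+a≥ = +-cancelʳ-≤ (a * a + 2 * (r * r) + 2 * (1 + r) + (1 + r)) _ _ (begin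
  1 + (P + (1 + r) * (1 + r)) + (a * a + 2 * (r * r) + 2 * (1 + r) + (1 + r))
    ≤⟨ +-monoʳ-≤ (1 + (P + (1 + r) * (1 + r))) (+-monoˡ-≤ (1 + r) e+a≥) ⟩
  1 + (P + (1 + r) * (1 + r)) + (e + a + (1 + r))
    ≡⟨ solve (P ∷ r ∷ e ∷ a ∷ []) ⟩
  e + P + ((1 + r) + a) + (1 + (1 + r) * (1 + r))
    ≡⟨ cong (_+ (1 + (1 + r) * (1 + r))) e+P+n≡n² ⟩
  ((1 + r) + a) * ((1 + r) + a) + (1 + (1 + r) * (1 + r))
    ≤⟨ ≤-offset 1 (solve (r ∷ a ∷ [])) ⟩
  2 * ((1 + r) * a) + (1 + r) + (a * a + 2 * (r * r) + 2 * (1 + r) + (1 + r)) ∎)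
  where open ≤-Reasoning

2*nC2+n≡n*n : ∀ m → 2 * (m C 2) + m ≡ m * m
2*nC2+n≡n*n zero    = refl
2*nC2+n≡n*n (suc m) = begin
  2 * (suc m C 2) + suc m           ≡⟨ cong (λ x → 2 * x + suc m) (nCk+nC[k+1]≡[n+1]C[k+1] m 1) ⟨
  2 * (m C 1 + m C 2) + suc m       ≡⟨ cong (λ x → 2 * (x + m C 2) + suc m) (nC1≡n m) ⟩
  2 * (m + m C 2) + suc m           ≡⟨ regroup m (m C 2) ⟩
  (2 * (m C 2) + m) + (2 * m + 1)   ≡⟨ cong (_+ (2 * m + 1)) (2*nC2+n≡n*n m) ⟩
  m * m + (2 * m + 1)               ≡⟨ solve (m ∷ []) ⟩
  suc m * suc m                     ∎
  where
  open ≡-Reasoning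
  regroup : ∀ m c → 2 * (m + c) + suc m ≡ (2 * c + m) + (2 * m + 1)
  regroup = solve-∀

-- Sparse graphs with heavy edges

degreeAtLeast : Graph n → ℕ → Fin n → Bool
degreeAtLeast K a u = does (a ≤? deg K u)

module _ (K : Graph n) (heavy : HasHeavyEdges n K) (a : ℕ) where

  private
    high : Fin n → Bool
    high = degreeAtLeast K a
    h : ℕ
    h = count high
    L : Graph n
    L = K ∖ high

  high⇒a≤deg : ∀ u → high u ≡ true → a ≤ deg K u
  high⇒a≤deg u = does-true⇒ (a ≤? deg K u)

  low⇒deg<a : ∀ u → high u ≡ false → deg K u < a
  low⇒deg<a u = ≰⇒> ∘ does-false⇒¬ (a ≤? deg K u)

  high-bound : 2 * (h * a) + h ≤ arcsTouching K high + h * h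
  high-bound = begin
    2 * (h * a) + h               ≤⟨ +-monoˡ-≤ h (*-monoʳ-≤ 2 (count*≤sumOver high (deg K) high⇒a≤deg)) ⟩
    2 * sumOver high (deg K) + h  ≤⟨ twice-sumOver-deg≤arcsTouching K high ⟩
    arcsTouching K high + h * h   ∎
    where open ≤-Reasoning

  many-high⇒dense : ∀ {s} → s ≤ h → 3 * s ≤ 2 * a + 1 → 2 * (s * a) + s ≤ arcs K + s * s
  many-high⇒dense s≤h 3s≤ = many-high-bound s≤h 3s≤ h*a≤arcs (≤-trans high-bound (+-monoˡ-≤ (h * h) touching≤arcs))
    where
    h*a≤arcs : h * a ≤ arcs K
    h*a≤arcs = ≤-trans (count*≤sumOver high (deg K) high⇒a≤deg) (sumOver-deg≤arcs K high)
    touching≤arcs : arcsTouching K high ≤ arcs K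
    touching≤arcs = ≤-trans (m≤m+n _ _) (arcsTouching+arcsTouching-∖≤arcs K high (λ _ → false))

  low-edge⇒dense : ∀ {c} → 5 * (h + c) ≤ a + 1 → h + c + a ≡ n → ∃ (HasNeighbour L) →
                   2 * ((h + c) * a) + (h + c) ≤ arcs K + (h + c) * (h + c)
  low-edge⇒dense {c} five n≡ edge with minimiser (hasNeighbour? L) (deg L) edge
  ... | u₀ , (v₀ , u₀v₀) , minimal =
    few-high-bound five c≤x (arcsTouching+arcsTouching-∖≤arcs K high Y) high-bound
                   (twice-sumOver-deg≤arcsTouching L Y) x²≤Σ lower
    where
    x : ℕ
    x = deg L u₀
    Y : Fin n → Bool
    Y = adj L u₀
    deg-u₀ : deg K u₀ ≤ x + h
    deg-u₀ = deg≤deg-∖+count K high (proj₁ (proj₂ (adj-∖ K high u₀v₀)))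
    heavy-from-u₀ : ∀ {z} → Adj L u₀ z → n ≤ x + h + deg K z
    heavy-from-u₀ {z} u₀z = ≤-trans (heavy u₀ z (proj₁ (adj-∖ K high u₀z))) (+-monoˡ-≤ (deg K z) deg-u₀)
    c≤x : c ≤ x
    c≤x = +-cancelʳ-≤ (h + a) c x (begin
      c + (h + a)          ≡⟨ trans (sym (+-assoc c h a)) (cong (_+ a) (+-comm c h)) ⟩
      h + c + a            ≡⟨ n≡ ⟩
      n                    ≤⟨ heavy-from-u₀ u₀v₀ ⟩
      x + h + deg K v₀     ≤⟨ +-monoʳ-≤ (x + h) (<⇒≤ (low⇒deg<a v₀ (proj₂ (proj₂ (adj-∖ K high u₀v₀))))) ⟩
      x + h + a            ≡⟨ +-assoc x h a ⟩
      x + (h + a)          ∎)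
      where open ≤-Reasoning
    x²≤Σ : x * x ≤ sumOver Y (deg L)
    x²≤Σ = count*≤sumOver Y (deg L) λ z u₀z → minimal z (u₀ , trans (adj-sym L z u₀) u₀z)
    lower : x * (h + c + a) ≤ sumOver Y (deg L) + x * (2 * h + x)
    lower rewrite n≡ = count*≤sumOver+count* Y (deg L) λ z u₀z → begin
      n                             ≤⟨ heavy-from-u₀ u₀z ⟩
      x + h + deg K z               ≤⟨ +-monoʳ-≤ (x + h) (deg≤deg-∖+count K high (proj₂ (proj₂ (adj-∖ K high u₀z)))) ⟩
      x + h + (deg L z + h)         ≡⟨ regroup x h (deg L z) ⟩
      deg L z + (2 * h + x)         ∎
      where
      open ≤-Reasoning
      regroup : ∀ x h d → x + h + (d + h) ≡ d + (2 * h + x)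
      regroup = solve-∀

  sparse⇒large-independent : ∀ {s} → s + a ≡ n → 5 * s ≤ a + 1 → arcs K + s * s < 2 * (s * a) + s →
                             IsIndependent K (not ∘ degreeAtLeast K a) × a + 1 ≤ count (not ∘ degreeAtLeast K a)
  sparse⇒large-independent {s} s+a≡n five sparse with s ≤? h
  ... | yes s≤h = ⊥-elim (<⇒≱ sparse (many-high⇒dense s≤h 3s≤2a+1))
    where
    3s≤2a+1 : 3 * s ≤ 2 * a + 1
    3s≤2a+1 = ≤-trans (*-monoˡ-≤ s {3} {5} (s≤s (s≤s (s≤s z≤n)))) (≤-trans five (+-monoˡ-≤ 1 (m≤n*m a 2)))
  ... | no s≰h with s ∸ h | m+[n∸m]≡n (<⇒≤ (≰⇒> s≰h))
  ...   | c | refl with any? (hasNeighbour? L)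
  ...     | yes edge    = ⊥-elim (<⇒≱ sparse (low-edge⇒dense five s+a≡n edge))
  ...     | no edgeless = edgeless-∖⇒independent K high (λ u v uv → edgeless (u , v , uv)) , size
    where
    size : a + 1 ≤ count (not ∘ high)
    size = +-cancelʳ-≤ h (a + 1) _ (begin
      a + 1 + h                  ≡⟨ +-assoc a 1 h ⟩
      a + suc h                  ≤⟨ +-monoʳ-≤ a (≰⇒> s≰h) ⟩
      a + (h + c)                ≡⟨ +-comm a (h + c) ⟩
      h + c + a                  ≡⟨ s+a≡n ⟩
      n                          ≡⟨ count-not+count high ⟨
      count (not ∘ high) + h     ∎)
      where open ≤-Reasoning

closed-dense⇒clique : ∀ {s a} (G : Graph n) → IsClosed (n ∸ 1) G → 1 ≤ s → s + a ≡ n → 5 * s ≤ a + 1 →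
                      a * a + 2 * ((s ∸ 1) * (s ∸ 1)) + 2 * s ≤ 2 * edges G + a →
                      CliqueNumberAtLeast G (a + 1)
closed-dense⇒clique {n} {s} {a} G closed s≥1 s+a≡n five dense =
  Vec.tabulate X , independent-complement⇒clique G independent , ≤-trans large (≤-reflexive (sym (∣tabulate∣≡count X)))
  where
  Ḡ : Graph n
  Ḡ = complement G
  X : Fin n → Bool
  X = not ∘ degreeAtLeast Ḡ a
  sparse : arcs Ḡ + s * s < 2 * (s * a) + s
  sparse = complement-arcs-bound s≥1 (subst (λ m → arcs G + arcs Ḡ + m ≡ m * m) (sym s+a≡n) (arcs+arcs-complement G))
                                     (subst (λ e → _ ≤ e + a) (handshake G) dense)
  independent-and-large : IsIndependent Ḡ X × a + 1 ≤ count X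
  independent-and-large = sparse⇒large-independent Ḡ (closed⇒complement-heavy G closed) a s+a≡n five sparse
  independent : IsIndependent Ḡ X
  independent = proj₁ independent-and-large
  large : a + 1 ≤ count X
  large = proj₂ independent-and-large

order-bounds : ∀ k t n → 1 ≤ k + t → n ≥ 6 * k + 6 * t ∸ 1 →
               k + t + (n ∸ k ∸ t) ≡ n × 5 * (k + t) ≤ n ∸ k ∸ t + 1
order-bounds k t n s≥1 n≥ rewrite ∸-+-assoc n k t = s+a≡n , five
  where
  s : ℕ
  s = k + t
  6s≤n+1 : 6 * s ≤ n + 1
  6s≤n+1 = begin
    6 * s                   ≡⟨ *-distribˡ-+ 6 k t ⟩
    6 * k + 6 * t           ≤⟨ m≤n+m∸n (6 * k + 6 * t) 1 ⟩
    1 + (6 * k + 6 * t ∸ 1) ≤⟨ +-monoʳ-≤ 1 n≥ ⟩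
    1 + n                   ≡⟨ +-comm 1 n ⟩
    n + 1                   ∎
    where open ≤-Reasoning
  s+a≡n : s + (n ∸ s) ≡ n
  s+a≡n = m+[n∸m]≡n (+-cancelʳ-≤ 1 s n (≤-trans (+-monoʳ-≤ s (≤-trans s≥1 (m≤n*m s 5))) 6s≤n+1))
  five : 5 * s ≤ n ∸ s + 1
  five = +-cancelˡ-≤ s _ _ (begin
    6 * s             ≤⟨ 6s≤n+1 ⟩
    n + 1             ≡⟨ cong (_+ 1) s+a≡n ⟨
    s + (n ∸ s) + 1   ≡⟨ +-assoc s (n ∸ s) 1 ⟩
    s + (n ∸ s + 1)   ∎)
    where open ≤-Reasoning

doubled-edge-bound : ∀ {e} a r k t → a C 2 + r ^ 2 + k + t ≤ e →
                     a * a + 2 * (r * r) + 2 * (k + t) ≤ 2 * e + a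
doubled-edge-bound {e} a r k t bound = begin
  a * a + 2 * (r * r) + 2 * (k + t)            ≡⟨ cong (λ x → x + 2 * (r * r) + 2 * (k + t)) (2*nC2+n≡n*n a) ⟨
  2 * (a C 2) + a + 2 * (r * r) + 2 * (k + t)  ≡⟨ regroup (a C 2) a r k t ⟩
  2 * (a C 2 + r ^ 2 + k + t) + a              ≤⟨ +-monoˡ-≤ a (*-monoʳ-≤ 2 bound) ⟩
  2 * e + a                                    ∎
  where
  open ≤-Reasoning
  regroup : ∀ c a r k t → 2 * c + a + 2 * (r * r) + 2 * (k + t) ≡ 2 * (c + r * (r * 1) + k + t) + a
  regroup = solve-∀

lemma2p2 : (k t n : ℕ) → k ≥ 2 → t ≥ 1 → n ≥ 6 * k + 6 * t ∸ 1
    → (G : Graph n) → IsClosed (n ∸ 1) G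
    → edges G ≥ (n ∸ k ∸ t) C 2 + (k + t ∸ 1) ^ 2 + k + t
    → CliqueNumberAtLeast G (n ∸ k ∸ t + 1)
lemma2p2 k t n _ t≥1 n≥ G closed many-edges =
  closed-dense⇒clique G closed s≥1 (proj₁ bounds) (proj₂ bounds)
    (doubled-edge-bound (n ∸ k ∸ t) (k + t ∸ 1) k t many-edges)
  where
  s≥1 : 1 ≤ k + t
  s≥1 = ≤-trans t≥1 (m≤n+m t k)
  bounds : k + t + (n ∸ k ∸ t) ≡ n × 5 * (k + t) ≤ n ∸ k ∸ t + 1
  bounds = order-bounds k t n s≥1 n≥
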